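{- Let $\mathit{cs}_0$ be a finite constant specification and $A$ an axiom of $\mathsf{J}^+$ such that $\mathsf{J}^+_{\mathit{cs}_0}\vdash A$. Then there exist a finite constant specification $\mathit{cs}_1\supseteq\mathit{cs}_0$ and a ground second-sort justification term $s$ such that $\mathsf{J}^+_{\mathit{cs}_1}\vdash[s]_{\mathsf{tc}}A$. Moreover, if $\mathit{cs}_0$ is injective, then $\mathit{cs}_1$ can be chosen injective.
   Context: Justification terms of two sorts are built simultaneously from first-sort variables $x_0,x_1,\dots$, second-sort variables $y_0,y_1,\dots$ and second-sort constants $c_0,c_1,\dots$: first-sort $w::=x_i\mid(w\cdot w)\mid\mathsf{head}(s)\mid\mathsf{tail}(s)\mid(w+w)$; second-sort $s::=y_i\mid c_i\mid(s\cdot s)\mid\mathsf{ind}(w,s)\mid(s+s)$. A term is ground if it contains no variables. Formulas: $A::=p_i\mid\bot\mid(A\to A)\mid[w]A\mid[s]_{\mathsf{tc}}A$; $\neg A:=A\to\bot$, $A\wedge B:=\neg(A\to\neg B)$, $A\vee B:=\neg A\to B$. $\mathsf{J}^+_0$ has the rule modus ponens and axioms (for all formulas $A,B,C$, first-sort $h,w$, second-sort $t,s$): (i) $A\to(B\to A)$; (ii) $(A\to(B\to C))\to((A\to B)\to(A\to C))$; (iii) $\neg\neg A\to A$; (iv) $[h](A\to B)\to([w]A\to[h\cdot w]B)$; (v) $[h]A\vee[w]A\to[h+w]A$; (vi) $[t]_{\mathsf{tc}}(A\to B)\to([s]_{\mathsf{tc}}A\to[t\cdot s]_{\mathsf{tc}}B)$;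 (vii) $[s]_{\mathsf{tc}}A\to[\mathsf{head}(s)]A$; (viii) $[s]_{\mathsf{tc}}A\to[\mathsf{tail}(s)][s]_{\mathsf{tc}}A$; (ix) $[w]A\wedge[s]_{\mathsf{tc}}(A\to[w]A)\to[\mathsf{ind}(w,s)]_{\mathsf{tc}}A$; (x) $[t]_{\mathsf{tc}}A\vee[s]_{\mathsf{tc}}A\to[t+s]_{\mathsf{tc}}A$. The axioms of $\mathsf{J}^+$ are the axioms of $\mathsf{J}^+_0$ together with all formulas $[c]_{\mathsf{tc}}A$ with $c$ a constant and $A$ an axiom of $\mathsf{J}^+_0$. A constant specification is a set of formulas of the latter form; $\mathsf{J}^+_{\mathit{cs}}$ is $\mathsf{J}^+_0$ with the members of $\mathit{cs}$ added as axioms. $\mathit{cs}$ is injective if $[c]_{\mathsf{tc}}A,[c]_{\mathsf{tc}}B\in\mathit{cs}$ implies $A=B$. -}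

module Defs where

open import Data.Nat using (ℕ)
open import Data.List using (List)
open import Data.List.Membership.Propositional using (_∈_)
open import Data.List.Relation.Unary.All using (All)
open import Data.Product using (Σ; _×_)
open import Relation.Binary.PropositionalEquality using (_≡_)

mutual
  data Tm₁ : Set where
    x     : ℕ → Tm₁
    _·₁_  : Tm₁ → Tm₁ → Tm₁
    head  : Tm₂ → Tm₁
    tail  : Tm₂ → Tm₁
    _+₁_  : Tm₁ → Tm₁ → Tm₁

  data Tm₂ : Set where
    y     : ℕ → Tm₂
    c     : ℕ → Tm₂
    _·₂_  : Tm₂ → Tm₂ → Tm₂
    ind   : Tm₁ → Tm₂ → Tm₂
    _+₂_  : Tm₂ → Tm₂ → Tm₂

mutual
  data Ground₁ : Tm₁ → Set where
    g·   : ∀ {h w} → Ground₁ h → Ground₁ w → Ground₁ (h ·₁ w)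
    ghead : ∀ {s} → Ground₂ s → Ground₁ (head s)
    gtail : ∀ {s} → Ground₂ s → Ground₁ (tail s)
    g+   : ∀ {h w} → Ground₁ h → Ground₁ w → Ground₁ (h +₁ w)

  data Ground₂ : Tm₂ → Set where
    gc   : ∀ i → Ground₂ (c i)
    g·   : ∀ {t s} → Ground₂ t → Ground₂ s → Ground₂ (t ·₂ s)
    gind : ∀ {w s} → Ground₁ w → Ground₂ s → Ground₂ (ind w s)
    g+   : ∀ {t s} → Ground₂ t → Ground₂ s → Ground₂ (t +₂ s)

infixr 5 _⇒_
infix 8 [_]_ [_]tc_
infixr 6 _∧'_ _∨'_
data Form : Set where
  p    : ℕ → Form
  ⊥'   : Form
  _⇒_  : Form → Form → Form
  [_]_ : Tm₁ → Form → Form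
  [_]tc_ : Tm₂ → Form → Form

¬' : Form → Form
¬' A = A ⇒ ⊥'

_∧'_ : Form → Form → Form
A ∧' B = ¬' (A ⇒ ¬' B)

_∨'_ : Form → Form → Form
A ∨' B = ¬' A ⇒ B

data AxJ0 : Form → Set where
  ax1  : ∀ A B → AxJ0 (A ⇒ (B ⇒ A))
  ax2  : ∀ A B C → AxJ0 ((A ⇒ (B ⇒ C)) ⇒ ((A ⇒ B) ⇒ (A ⇒ C)))
  ax3  : ∀ A → AxJ0 (¬' (¬' A) ⇒ A)
  ax4  : ∀ h w A B → AxJ0 ([ h ] (A ⇒ B) ⇒ ([ w ] A ⇒ [ h ·₁ w ] B))
  ax5  : ∀ h w A → AxJ0 (([ h ] A ∨' [ w ] A) ⇒ [ h +₁ w ] A)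
  ax6  : ∀ t s A B → AxJ0 ([ t ]tc (A ⇒ B) ⇒ ([ s ]tc A ⇒ [ t ·₂ s ]tc B))
  ax7  : ∀ s A → AxJ0 ([ s ]tc A ⇒ [ head s ] A)
  ax8  : ∀ s A → AxJ0 ([ s ]tc A ⇒ [ tail s ] ([ s ]tc A))
  ax9  : ∀ w s A → AxJ0 (([ w ] A ∧' [ s ]tc (A ⇒ [ w ] A)) ⇒ [ ind w s ]tc A)
  ax10 : ∀ t s A → AxJ0 (([ t ]tc A ∨' [ s ]tc A) ⇒ [ t +₂ s ]tc A)

data AxJ+ : Form → Set where
  base  : ∀ {A} → AxJ0 A → AxJ+ A
  const : ∀ i {A} → AxJ0 A → AxJ+ ([ c i ]tc A)

data CSFormula : Form → Set where
  csf : ∀ i {A} → AxJ0 A → CSFormula ([ c i ]tc A)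

CS : Set
CS = List Form

IsCS : CS → Set
IsCS cs = All CSFormula cs

_⊆cs_ : CS → CS → Set
cs ⊆cs cs' = ∀ {F} → F ∈ cs → F ∈ cs'

Injective : CS → Set
Injective cs = ∀ i A B → ([ c i ]tc A) ∈ cs → ([ c i ]tc B) ∈ cs → A ≡ B

data _⊢_ (cs : CS) : Form → Set where
  ax  : ∀ {A} → AxJ0 A → cs ⊢ A
  csa : ∀ {A} → A ∈ cs → cs ⊢ A
  mp  : ∀ {A B} → cs ⊢ (A ⇒ B) → cs ⊢ A → cs ⊢ B

{-# OPTIONS --safe #-}
-- Assign to a constant c_j not occurring in cs₀ a suitable axiom B of J⁺₀; adding
-- [c_j]tc B keeps cs₀ injective because c_j is fresh.  If A is itself an axiom of
-- J⁺₀, take B = A and s = c_j.  If A = [c_i]tc A′, take for B the instance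
-- [c_i]tc A′ ⇒ [tail c_i][c_i]tc A′ of axiom (viii): it is the induction step for
-- A, whose base [tail c_i]A follows from A by that same axiom, so axiom (ix) gives
-- [ind(tail c_i, c_j)]tc A.  Only this second case uses the derivation of A.
module Submission where

open import Defs
open import Data.Product using (Σ; _×_; _,_)
open import Data.Nat using (ℕ; suc; _⊔_; _≤_)
open import Data.Nat.Properties using (m≤m⊔n; m≤n⇒m≤o⊔n; 1+n≰n)
open import Data.List using ([]; _∷_)
open import Data.List.Relation.Unary.All using (_∷_)
open import Data.List.Relation.Unary.Any using (here; there)
open import Data.List.Membership.Propositional using (_∈_)
open import Relation.Binary.PropositionalEquality using (refl)
open import Data.Empty using (⊥-elim)

⊢-mono : ∀ {cs cs′ A} → cs ⊆cs cs′ → cs ⊢ A → cs′ ⊢ A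
⊢-mono sub (ax a)   = ax a
⊢-mono sub (csa m)  = csa (sub m)
⊢-mono sub (mp d e) = mp (⊢-mono sub d) (⊢-mono sub e)

⊢-id : ∀ {cs} A → cs ⊢ (A ⇒ A)
⊢-id A = mp (mp (ax (ax2 A (A ⇒ A) A)) (ax (ax1 A (A ⇒ A)))) (ax (ax1 A A))

⊢-∧-intro : ∀ {cs A B} → cs ⊢ A → cs ⊢ B → cs ⊢ (A ∧' B)
⊢-∧-intro {cs} {A} {B} dA dB =
  mp (mp (ax (ax2 F B ⊥')) F⇒¬B) (mp (ax (ax1 B F)) dB)
  where
    F : Form
    F = A ⇒ ¬' B
    F⇒¬B : cs ⊢ (F ⇒ ¬' B)
    F⇒¬B = mp (mp (ax (ax2 F A (¬' B))) (⊢-id F)) (mp (ax (ax1 A F)) dA)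

constIndex : Form → ℕ
constIndex ([ c i ]tc _) = i
constIndex _             = 0

maxConstIndex : CS → ℕ
maxConstIndex []       = 0
maxConstIndex (F ∷ cs) = constIndex F ⊔ maxConstIndex cs

∈⇒≤maxConstIndex : ∀ {cs i A} → ([ c i ]tc A) ∈ cs → i ≤ maxConstIndex cs
∈⇒≤maxConstIndex {F ∷ cs} (here refl) = m≤m⊔n _ (maxConstIndex cs)
∈⇒≤maxConstIndex {F ∷ cs} (there m)   = m≤n⇒m≤o⊔n (constIndex F) (∈⇒≤maxConstIndex m)

freshConst : CS → ℕ
freshConst cs = suc (maxConstIndex cs)

∷-freshConst-injective : ∀ {cs} B → Injective cs →
  Injective (([ c (freshConst cs) ]tc B) ∷ cs)
∷-freshConst-injective B inj i A A′ (here refl) (here refl) = refl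
∷-freshConst-injective B inj i A A′ (here refl) (there m)   = ⊥-elim (1+n≰n (∈⇒≤maxConstIndex m))
∷-freshConst-injective B inj i A A′ (there m)   (here refl) = ⊥-elim (1+n≰n (∈⇒≤maxConstIndex m))
∷-freshConst-injective B inj i A A′ (there m)   (there m′)  = inj i A A′ m m′

module _ {A : Form} where

  certifiedAxiom : AxJ+ A → Form
  certifiedAxiom (base _)          = A
  certifiedAxiom (const i {A′} _) = [ c i ]tc A′ ⇒ [ tail (c i) ] [ c i ]tc A′

  certifiedAxiom-isAxiom : (a : AxJ+ A) → AxJ0 (certifiedAxiom a)
  certifiedAxiom-isAxiom (base a)         = a
  certifiedAxiom-isAxiom (const i {A′} _) = ax8 (c i) A′

  certificate : AxJ+ A → ℕ → Tm₂
  certificate (base _)    j = c j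
  certificate (const i _) j = ind (tail (c i)) (c j)

  certificate-ground : (a : AxJ+ A) → ∀ j → Ground₂ (certificate a j)
  certificate-ground (base _)    j = gc j
  certificate-ground (const i _) j = gind (gtail (gc i)) (gc j)

  ⊢-certificate : ∀ {cs} (a : AxJ+ A) j → ([ c j ]tc certifiedAxiom a) ∈ cs →
    cs ⊢ A → cs ⊢ ([ certificate a j ]tc A)
  ⊢-certificate (base _) j m _ = csa m
  ⊢-certificate (const i {A′} _) j m dA =
    mp (ax (ax9 (tail (c i)) (c j) A))
       (⊢-∧-intro (mp (ax (ax8 (c i) A′)) dA) (csa m))

mainTheorem5 : (cs₀ : CS) → IsCS cs₀ → (A : Form) → AxJ+ A → cs₀ ⊢ A →
    (Σ CS λ cs₁ → IsCS cs₁ × cs₀ ⊆cs cs₁ ×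
       Σ Tm₂ λ s → Ground₂ s × cs₁ ⊢ ([ s ]tc A))
    × (Injective cs₀ → Σ CS λ cs₁ → IsCS cs₁ × cs₀ ⊆cs cs₁ × Injective cs₁ ×
       Σ Tm₂ λ s → Ground₂ s × cs₁ ⊢ ([ s ]tc A))
mainTheorem5 cs₀ isCS₀ A a dA =
    (cs₁ , isCS₁ , there , s , s-ground , ⊢s)
  , λ inj₀ → cs₁ , isCS₁ , there , ∷-freshConst-injective B inj₀ , s , s-ground , ⊢s
  where
    j : ℕ
    j = freshConst cs₀
    B : Form
    B = certifiedAxiom a
    cs₁ : CS
    cs₁ = ([ c j ]tc B) ∷ cs₀
    isCS₁ : IsCS cs₁
    isCS₁ = csf j (certifiedAxiom-isAxiom a) ∷ isCS₀
    s : Tm₂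
    s = certificate a j
    s-ground : Ground₂ s
    s-ground = certificate-ground a j
    ⊢s : cs₁ ⊢ ([ s ]tc A)
    ⊢s = ⊢-certificate a j (here refl) (⊢-mono there dA)
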